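{- Every weight $w=(0,a,b,c)\in\mathbb Z^4$ with $0\le a\le b\le c$ dominates one of the following weights: $(0,0,0,0)$, $(0,0,0,1)$, $(0,1,1,1)$, $(0,0,1,1)$, $(0,0,1,2)$, $(0,1,2,2)$, $(0,1,1,2)$, $(0,1,1,3)$, $(0,2,2,3)$, $(0,1,2,3)$, $(0,1,2,4)$, $(0,2,3,4)$.
   Context: A weight is an element $w=(w_1,w_2,w_3,w_4)\in\mathbb Z^4$. The weight $w$ dominates the weight $w'=(w_1',w_2',w_3',w_4')$ if \[\max(1+w_1+w_2+w_3+w_4-w_i-w_j-w_k-w_l,\,0)\ \ge\ \max(1+w_1'+w_2'+w_3'+w_4'-w_i'-w_j'-w_k'-w_l',\,0)\] for all $1\le i<j\le4$ and $1\le k<l\le 4$. -}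

module Defs where

open import Data.Integer using (ℤ; +_; _+_; _-_; _⊔_; _≤_)
open import Data.Fin using (Fin; zero; suc; _<_)
open import Data.List using (List; _∷_; [])
open import Data.List.Relation.Unary.Any using (Any)

Weight : Set
Weight = Fin 4 → ℤ

mkW : ℤ → ℤ → ℤ → ℤ → Weight
mkW a b c d zero = a
mkW a b c d (suc zero) = b
mkW a b c d (suc (suc zero)) = c
mkW a b c d (suc (suc (suc zero))) = d

total : Weight → ℤ
total w = w zero + w (suc zero) + w (suc (suc zero)) + w (suc (suc (suc zero)))

term : Weight → Fin 4 → Fin 4 → Fin 4 → Fin 4 → ℤ
term w i j k l = ((+ 1) + total w - w i - w j - w k - w l) ⊔ (+ 0)

Dominates : Weight → Weight → Set
Dominates w w' = ∀ (i j k l : Fin 4) → i < j → k < l → term w' i j k l ≤ term w i j k l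

targets : List Weight
targets =
  mkW (+ 0) (+ 0) (+ 0) (+ 0) ∷
  mkW (+ 0) (+ 0) (+ 0) (+ 1) ∷
  mkW (+ 0) (+ 1) (+ 1) (+ 1) ∷
  mkW (+ 0) (+ 0) (+ 1) (+ 1) ∷
  mkW (+ 0) (+ 0) (+ 1) (+ 2) ∷
  mkW (+ 0) (+ 1) (+ 2) (+ 2) ∷
  mkW (+ 0) (+ 1) (+ 1) (+ 2) ∷
  mkW (+ 0) (+ 1) (+ 1) (+ 3) ∷
  mkW (+ 0) (+ 2) (+ 2) (+ 3) ∷
  mkW (+ 0) (+ 1) (+ 2) (+ 3) ∷
  mkW (+ 0) (+ 1) (+ 2) (+ 4) ∷
  mkW (+ 0) (+ 2) (+ 3) (+ 4) ∷
  []

-- Write w = (0, x, x+y, x+y+z) with x, y, z ≥ 0.  Inside the maximum, the quantity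
-- 1 + w₁+w₂+w₃+w₄ − wᵢ − wⱼ − wₖ − wₗ is affine in w, so w dominates t as soon as
-- w = t + v for a v whose linear part is non-negative at every index quadruple
-- where t's excess is positive.  For fixed t these v form a cone.  Splitting the
-- (x, y, z)-octant by which coordinates vanish and by how x compares with z gives
-- twelve regions, each a target t plus a cone spanned by some of (0,0,0,1),
-- (0,0,1,1), (0,1,1,1), (0,1,1,2); the finitely many sign conditions for these
-- generators are verified by evaluation.
module Submission where

open import Defs
open import Data.Integer using (ℤ; +_; _≤_)
open import Data.Product using (_×_)
open import Data.List.Relation.Unary.Any using (Any)

open import Data.Fin using (Fin; zero; suc; _<_; #_)
open import Data.Fin.Properties using (all?) renaming (_<?_ to _<ᶠ?_)
open import Data.Integer using (_+_; _-_; _⊔_; +≤+; nonNegative)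
import Data.Integer.Properties as ℤ
open import Data.Integer.Tactic.RingSolver using (solve-∀)
open import Data.List using (List; []; _∷_; length; lookup)
open import Data.List.Membership.Propositional using (lose)
open import Data.List.Membership.Propositional.Properties using (∈-lookup)
open import Data.List.Relation.Unary.Any using (map)
open import Data.Nat as ℕ using (ℕ; zero; suc; compare; less; equal; greater)
open import Data.Nat.Properties using (m≤n⇒∃[o]m+o≡n)
open import Data.Nat.Tactic.RingSolver using (solve)
open import Data.Product using (_,_)
open import Data.Sum using (_⊎_; inj₁; inj₂; map₂)
open import Function using (_∘_)
open import Relation.Binary.PropositionalEquality using (_≡_; _≗_; refl; sym; cong; subst)
open import Relation.Nullary.Decidable using (Dec; True; toWitness; map′; _→-dec_; _⊎-dec_)

excess : Weight → Fin 4 → Fin 4 → Fin 4 → Fin 4 → ℤ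
excess w i j k l = + 1 + total w - w i - w j - w k - w l

deficit : Weight → Fin 4 → Fin 4 → Fin 4 → Fin 4 → ℤ
deficit v i j k l = total v - v i - v j - v k - v l

_⊕_ : Weight → Weight → Weight
(u ⊕ v) m = u m + v m

excess-cong : ∀ {w w′} → w ≗ w′ → ∀ i j k l → excess w i j k l ≡ excess w′ i j k l
excess-cong e i j k l
  rewrite e zero | e (suc zero) | e (suc (suc zero)) | e (suc (suc (suc zero)))
        | e i | e j | e k | e l = refl

deficit-cong : ∀ {v v′} → v ≗ v′ → ∀ i j k l → deficit v i j k l ≡ deficit v′ i j k l
deficit-cong e i j k l
  rewrite e zero | e (suc zero) | e (suc (suc zero)) | e (suc (suc (suc zero)))
        | e i | e j | e k | e l = refl

excess-⊕ : ∀ t v i j k l → excess (t ⊕ v) i j k l ≡ excess t i j k l + deficit v i j k l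
excess-⊕ t v i j k l =
  identity (t zero) (t (suc zero)) (t (suc (suc zero))) (t (suc (suc (suc zero))))
           (t i) (t j) (t k) (t l)
           (v zero) (v (suc zero)) (v (suc (suc zero))) (v (suc (suc (suc zero))))
           (v i) (v j) (v k) (v l)
  where
  identity : ∀ t₀ t₁ t₂ t₃ tᵢ tⱼ tₖ tₗ v₀ v₁ v₂ v₃ vᵢ vⱼ vₖ vₗ →
    + 1 + ((t₀ + v₀) + (t₁ + v₁) + (t₂ + v₂) + (t₃ + v₃))
      - (tᵢ + vᵢ) - (tⱼ + vⱼ) - (tₖ + vₖ) - (tₗ + vₗ)
    ≡ (+ 1 + (t₀ + t₁ + t₂ + t₃) - tᵢ - tⱼ - tₖ - tₗ)
      + ((v₀ + v₁ + v₂ + v₃) - vᵢ - vⱼ - vₖ - vₗ)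
  identity = solve-∀

deficit-⊕ : ∀ u v i j k l → deficit (u ⊕ v) i j k l ≡ deficit u i j k l + deficit v i j k l
deficit-⊕ u v i j k l =
  identity (u zero) (u (suc zero)) (u (suc (suc zero))) (u (suc (suc (suc zero))))
           (u i) (u j) (u k) (u l)
           (v zero) (v (suc zero)) (v (suc (suc zero))) (v (suc (suc (suc zero))))
           (v i) (v j) (v k) (v l)
  where
  identity : ∀ u₀ u₁ u₂ u₃ uᵢ uⱼ uₖ uₗ v₀ v₁ v₂ v₃ vᵢ vⱼ vₖ vₗ →
    ((u₀ + v₀) + (u₁ + v₁) + (u₂ + v₂) + (u₃ + v₃))
      - (uᵢ + vᵢ) - (uⱼ + vⱼ) - (uₖ + vₖ) - (uₗ + vₗ)
    ≡ ((u₀ + u₁ + u₂ + u₃) - uᵢ - uⱼ - uₖ - uₗ)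
      + ((v₀ + v₁ + v₂ + v₃) - vᵢ - vⱼ - vₖ - vₗ)
  identity = solve-∀

record Compatible (t v : Weight) : Set where
  constructor compatible
  field
    excess≤0⊎deficit≥0 : ∀ (i j k l : Fin 4) → i < j → k < l →
                         excess t i j k l ≤ + 0 ⊎ + 0 ≤ deficit v i j k l

open Compatible

compatible? : ∀ t v → Dec (Compatible t v)
compatible? t v = map′ compatible excess≤0⊎deficit≥0 (all? λ i → all? λ j → all? λ k → all? λ l →
  i <ᶠ? j →-dec k <ᶠ? l →-dec
    (excess t i j k l ℤ.≤? + 0 ⊎-dec + 0 ℤ.≤? deficit v i j k l))

compatible-resp-≗ : ∀ {t v v′} → v ≗ v′ → Compatible t v → Compatible t v′
compatible-resp-≗ e (compatible p) = compatible λ i j k l i<j k<l →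
  map₂ (subst (+ 0 ≤_) (deficit-cong e i j k l)) (p i j k l i<j k<l)

compatible-⊕ : ∀ {t u v} → Compatible t u → Compatible t v → Compatible t (u ⊕ v)
compatible-⊕ {t} {u} {v} (compatible p) (compatible q) = compatible sum
  where
  sum : ∀ i j k l → i < j → k < l → excess t i j k l ≤ + 0 ⊎ + 0 ≤ deficit (u ⊕ v) i j k l
  sum i j k l i<j k<l with p i j k l i<j k<l | q i j k l i<j k<l
  ... | inj₁ e≤0 | _         = inj₁ e≤0
  ... | inj₂ _   | inj₁ e≤0  = inj₁ e≤0
  ... | inj₂ 0≤d | inj₂ 0≤d′ =
    inj₂ (subst (+ 0 ≤_) (sym (deficit-⊕ u v i j k l)) (ℤ.+-mono-≤ 0≤d 0≤d′))

-- Dominates wrapped in a record, so that Agda can infer weights from it.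
record _≽_ (w w′ : Weight) : Set where
  constructor dominates
  field
    unwrap : Dominates w w′

infix 4 _≽_

dominates-⊕ : ∀ {t v} → Compatible t v → t ⊕ v ≽ t
dominates-⊕ {t} {v} (compatible p) = dominates λ i j k l i<j k<l → bound i j k l (p i j k l i<j k<l)
  where
  open ℤ.≤-Reasoning
  bound : ∀ i j k l → excess t i j k l ≤ + 0 ⊎ + 0 ≤ deficit v i j k l → term t i j k l ≤ term (t ⊕ v) i j k l
  bound i j k l (inj₁ e≤0) = subst (_≤ term (t ⊕ v) i j k l) (sym (ℤ.i≤j⇒i⊔j≡j e≤0)) (ℤ.i≤j⊔i _ (+ 0))
  bound i j k l (inj₂ 0≤d) = begin
    excess t i j k l ⊔ + 0                        ≤⟨ ℤ.⊔-monoˡ-≤ (+ 0) (ℤ.i≤i+j _ _ {{nonNegative 0≤d}}) ⟩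
    (excess t i j k l + deficit v i j k l) ⊔ + 0  ≡⟨ cong (_⊔ + 0) (sym (excess-⊕ t v i j k l)) ⟩
    excess (t ⊕ v) i j k l ⊔ + 0                  ∎

dominates-resp-≗ : ∀ {t w w′} → w ≗ w′ → w ≽ t → w′ ≽ t
dominates-resp-≗ e (dominates p) = dominates λ i j k l i<j k<l →
  subst (_ ≤_) (cong (_⊔ + 0) (excess-cong e i j k l)) (p i j k l i<j k<l)

⟨_,_,_⟩ : ℕ → ℕ → ℕ → Weight
⟨ a , b , c ⟩ = mkW (+ 0) (+ a) (+ b) (+ c)

⟨⟩-⊕ : ∀ {a b c a′ b′ c′} → ⟨ a , b , c ⟩ ⊕ ⟨ a′ , b′ , c′ ⟩ ≗ ⟨ a ℕ.+ a′ , b ℕ.+ b′ , c ℕ.+ c′ ⟩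
⟨⟩-⊕ zero                   = refl
⟨⟩-⊕ (suc zero)             = refl
⟨⟩-⊕ (suc (suc zero))       = refl
⟨⟩-⊕ (suc (suc (suc zero))) = refl

⟨0,0,0⟩≗0 : ⟨ 0 , 0 , 0 ⟩ ≗ λ _ → + 0
⟨0,0,0⟩≗0 zero                   = refl
⟨0,0,0⟩≗0 (suc zero)             = refl
⟨0,0,0⟩≗0 (suc (suc zero))       = refl
⟨0,0,0⟩≗0 (suc (suc (suc zero))) = refl

compatible-0 : ∀ {t} → Compatible t ⟨ 0 , 0 , 0 ⟩
compatible-0 = compatible-resp-≗ (sym ∘ ⟨0,0,0⟩≗0) (compatible λ _ _ _ _ _ _ → inj₂ ℤ.≤-refl)

compatible-+ : ∀ {t a b c a′ b′ c′} → Compatible t ⟨ a , b , c ⟩ → Compatible t ⟨ a′ , b′ , c′ ⟩ →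
               Compatible t ⟨ a ℕ.+ a′ , b ℕ.+ b′ , c ℕ.+ c′ ⟩
compatible-+ p q = compatible-resp-≗ ⟨⟩-⊕ (compatible-⊕ p q)

compatible-* : ∀ {t a b c} n → Compatible t ⟨ a , b , c ⟩ → Compatible t ⟨ n ℕ.* a , n ℕ.* b , n ℕ.* c ⟩
compatible-* zero    p = compatible-0
compatible-* (suc n) p = compatible-+ p (compatible-* n p)

dominates-⟨⟩ : ∀ {s t u a b c a′ b′ c′} → Compatible ⟨ s , t , u ⟩ ⟨ a , b , c ⟩ →
               a′ ≡ s ℕ.+ a → b′ ≡ t ℕ.+ b → c′ ≡ u ℕ.+ c → ⟨ a′ , b′ , c′ ⟩ ≽ ⟨ s , t , u ⟩
dominates-⟨⟩ p refl refl refl = dominates-resp-≗ ⟨⟩-⊕ (dominates-⊕ p)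

checked : ∀ {t} g → {True (compatible? t g)} → Compatible t g
checked g {ok} = toWitness ok

any-at : ∀ {A : Set} {P : A → Set} {xs : List A} (i : Fin (length xs)) → P (lookup xs i) → Any P xs
any-at i = lose (∈-lookup i)

dominates-target-diagonal : ∀ x y z → Any (⟨ suc x , suc x ℕ.+ y , suc x ℕ.+ y ℕ.+ suc z ⟩ ≽_) targets
dominates-target-diagonal x zero z with compare x z
... | equal .x = any-at (# 6)
  (dominates-⟨⟩ (compatible-* x (checked ⟨ 1 , 1 , 2 ⟩))
    (solve (x ∷ [])) (solve (x ∷ [])) (solve (x ∷ [])))
... | less .x k = any-at (# 7)
  (dominates-⟨⟩ (compatible-+ (compatible-* x (checked ⟨ 1 , 1 , 2 ⟩)) (compatible-* k (checked ⟨ 0 , 0 , 1 ⟩)))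
    (solve (x ∷ k ∷ [])) (solve (x ∷ k ∷ [])) (solve (x ∷ k ∷ [])))
... | greater .z k = any-at (# 8)
  (dominates-⟨⟩ (compatible-+ (compatible-* z (checked ⟨ 1 , 1 , 2 ⟩)) (compatible-* k (checked ⟨ 1 , 1 , 1 ⟩)))
    (solve (z ∷ k ∷ [])) (solve (z ∷ k ∷ [])) (solve (z ∷ k ∷ [])))
dominates-target-diagonal x (suc y) z with compare x z
... | equal .x = any-at (# 9)
  (dominates-⟨⟩ (compatible-+ (compatible-* x (checked ⟨ 1 , 1 , 2 ⟩)) (compatible-* y (checked ⟨ 0 , 1 , 1 ⟩)))
    (solve (x ∷ y ∷ [])) (solve (x ∷ y ∷ [])) (solve (x ∷ y ∷ [])))
... | less .x k = any-at (# 10)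
  (dominates-⟨⟩ (compatible-+ (compatible-* x (checked ⟨ 1 , 1 , 2 ⟩))
                  (compatible-+ (compatible-* k (checked ⟨ 0 , 0 , 1 ⟩)) (compatible-* y (checked ⟨ 0 , 1 , 1 ⟩))))
    (solve (x ∷ k ∷ y ∷ [])) (solve (x ∷ k ∷ y ∷ [])) (solve (x ∷ k ∷ y ∷ [])))
... | greater .z k = any-at (# 11)
  (dominates-⟨⟩ (compatible-+ (compatible-* z (checked ⟨ 1 , 1 , 2 ⟩))
                  (compatible-+ (compatible-* k (checked ⟨ 1 , 1 , 1 ⟩)) (compatible-* y (checked ⟨ 0 , 1 , 1 ⟩))))
    (solve (z ∷ k ∷ y ∷ [])) (solve (z ∷ k ∷ y ∷ [])) (solve (z ∷ k ∷ y ∷ [])))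

dominates-target : ∀ x y z → Any (⟨ x , x ℕ.+ y , x ℕ.+ y ℕ.+ z ⟩ ≽_) targets
dominates-target zero zero zero = any-at (# 0) (dominates λ _ _ _ _ _ _ → ℤ.≤-refl)
dominates-target zero zero (suc z) = any-at (# 1)
  (dominates-⟨⟩ (compatible-* z (checked ⟨ 0 , 0 , 1 ⟩))
    (solve (z ∷ [])) (solve (z ∷ [])) (solve (z ∷ [])))
dominates-target (suc x) zero zero = any-at (# 2)
  (dominates-⟨⟩ (compatible-* x (checked ⟨ 1 , 1 , 1 ⟩))
    (solve (x ∷ [])) (solve (x ∷ [])) (solve (x ∷ [])))
dominates-target zero (suc y) zero = any-at (# 3)
  (dominates-⟨⟩ (compatible-* y (checked ⟨ 0 , 1 , 1 ⟩))
    (solve (y ∷ [])) (solve (y ∷ [])) (solve (y ∷ [])))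
dominates-target zero (suc y) (suc z) = any-at (# 4)
  (dominates-⟨⟩ (compatible-+ (compatible-* y (checked ⟨ 0 , 1 , 1 ⟩)) (compatible-* z (checked ⟨ 0 , 0 , 1 ⟩)))
    (solve (y ∷ z ∷ [])) (solve (y ∷ z ∷ [])) (solve (y ∷ z ∷ [])))
dominates-target (suc x) (suc y) zero = any-at (# 5)
  (dominates-⟨⟩ (compatible-+ (compatible-* x (checked ⟨ 1 , 1 , 1 ⟩)) (compatible-* y (checked ⟨ 0 , 1 , 1 ⟩)))
    (solve (x ∷ y ∷ [])) (solve (x ∷ y ∷ [])) (solve (x ∷ y ∷ [])))
dominates-target (suc x) y (suc z) = dominates-target-diagonal x y z

lemma4p2 : (a b c : ℤ) → + 0 ≤ a → a ≤ b → b ≤ c →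
    Any (λ w' → Dominates (mkW (+ 0) a b c) w') targets
lemma4p2 (+ x) (+ _) (+ _) (+≤+ _) (+≤+ x≤b) (+≤+ b≤c)
  with m≤n⇒∃[o]m+o≡n x≤b | m≤n⇒∃[o]m+o≡n b≤c
... | y , refl | z , refl = map _≽_.unwrap (dominates-target x y z)
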